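{- For every integer $k\ge 1$, $f_d(Q_{4k+1})\ge 4k+4$.
   Context: $Q_n$ is the $n$-dimensional hypercube: vertices are binary strings of length $n$, adjacent iff they differ in exactly one position. The \emph{Explorer–Director game} on a finite connected graph $G$ with starting vertex $v$: a token starts on $v$; in each round, with the token on $u$, the Explorer names a distance $d$ such that some vertex is at distance $d$ from $u$, and the Director moves the token to any vertex at distance exactly $d$ from $u$. Visited vertices are those the token has ever occupied (including $v$). The Explorer maximizes and the Director minimizes the number of visited vertices; the game ends when the Director can keep the token on visited vertices indefinitely; $f_d(G,v)$ is the final number of visited vertices under optimal play. Since $Q_n$ is vertex-transitive, $f_d(Q_n,v)$ does not depend on $v$ and is written $f_d(Q_n)$. -}

module Defs where

open import Data.Nat using (ℕ; zero; suc; _≤_)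
open import Data.Bool using (Bool)
open import Data.Fin using (Fin)
open import Data.Vec using (Vec; lookup)
open import Data.List using (List; []; _∷_; length)
open import Data.List.Membership.Propositional using (_∈_)
open import Data.List.Relation.Unary.All using (All)
open import Data.List.Relation.Unary.Unique.Propositional using (Unique)
open import Data.Product using (Σ; ∃; _×_)
open import Relation.Binary.PropositionalEquality using (_≡_; _≢_)

record Graph : Set₁ where
  field
    V   : Set
    Adj : V → V → Set

module _ (G : Graph) where
  open Graph G

  data Walk : V → V → ℕ → Set where
    []  : ∀ {u} → Walk u u 0
    _∷_ : ∀ {u v w n} → Adj u v → Walk v w n → Walk u w (suc n)

  Dist : V → V → ℕ → Set
  Dist u w d = Walk u w d × (∀ m → Walk u w m → d ≤ m)

  AtLeast : ℕ → List V → Set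
  AtLeast m vis = Σ (List V) λ xs → (length xs ≡ m) × Unique xs × All (_∈ vis) xs

  -- Forces m u vis : with the token on u and visited vertices vis, the Explorer
  -- has a strategy that, against every Director play, makes at least m distinct
  -- vertices visited after finitely many rounds.
  data Forces (m : ℕ) : V → List V → Set where
    done : ∀ {u vis} → AtLeast m vis → Forces m u vis
    move : ∀ {u vis} (d : ℕ)
         → (∃ λ w → Dist u w d)
         → (∀ w → Dist u w d → Forces m w (w ∷ vis))
         → Forces m u vis

  fd-≥ : V → ℕ → Set
  fd-≥ v m = Forces m v (v ∷ [])

Q : ℕ → Graph
Q n = record
  { V   = Vec Bool n
  ; Adj = λ x y → Σ (Fin n) λ i → (lookup x i ≢ lookup y i)
                                 × (∀ j → j ≢ i → lookup x j ≡ lookup y j)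
  }

-- Write n = 4k + 1 = 2K + 1 and call q, r apart when r is neither q nor its antipode q̄. The Explorer
-- collects apart vertices q, visiting each together with q̄, and K + 2 of them give 4k + 4 vertices.
-- Distances from a vertex x are grouped into the K + 1 classes {d, n − d}. Standing at the antipode of
-- the last collected vertex, if some class is hit by no collected vertex, the Explorer names a distance
-- of that class and then n: the Director's vertex is apart from all collected ones, and its antipode
-- follows. With at most K collected vertices some class is free, by pigeonhole. With K + 1 collected
-- and all classes hit (hence each exactly once), some collected q must itself see a free class, as
-- otherwise distances of class 1 would form a perfect matching on the odd number K + 1 = 2k + 1 of
-- collected vertices. The Explorer names the distance to q; the Director either answers with a new
-- apart vertex or, by uniqueness of classes, with q or q̄, and from there the class free for q is used.

module Submission where

open import Defs
open import Data.Nat using (ℕ; _+_; _*_; _≤_)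
open import Data.Bool using (Bool)
open import Data.Vec using (Vec)
open import Data.Nat using (zero; suc; _∸_; _⊓_; _<_; z≤n; s≤s; _≟_; _≤?_; anyUpTo?)
open import Data.Nat.Properties

open import Algebra.Properties.CommutativeSemigroup +-commutativeSemigroup using (interchange)
open import Data.Bool using (true; false; not) renaming (_≟_ to _≟ᵇ_)
open import Data.Empty using (⊥-elim)
open import Data.Fin using (zero; suc)
open import Data.List using (List; []; _∷_; length; map)
open import Data.List.Membership.DecPropositional _≟_ using (_∈?_)
open import Data.List.Membership.Propositional using (_∈_; _∉_; find)
open import Data.List.Membership.Propositional.Properties using (∈-map⁺)
open import Data.List.Properties using (length-map; map-cong)
open import Data.List.Relation.Unary.All as All using (All; []; _∷_)
open import Data.List.Relation.Unary.All.Properties using (¬Any⇒All¬; map⁺)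
open import Data.List.Relation.Unary.AllPairs using (AllPairs; []; _∷_)
open import Data.List.Relation.Unary.Any using (Any; here; there; any?)
open import Data.Nat.Tactic.RingSolver using (solve-∀)
open import Data.Product using (∃; _×_; _,_; proj₁; proj₂)
open import Data.Sum using (_⊎_; inj₁; inj₂)
open import Data.Vec using ([]; _∷_; lookup)
import Data.Vec as Vec
open import Data.Vec.Properties using (≡-dec; tabulate∘lookup; tabulate-cong)
open import Function using (_∘_)
open import Relation.Binary.PropositionalEquality
open import Relation.Nullary using (¬_; Dec; yes; no; ¬?)
open import Relation.Nullary.Decidable using (decidable-stable; _⊎-dec_)

bitDistance : Bool → Bool → ℕ
bitDistance false false = 0
bitDistance false true  = 1
bitDistance true  false = 1
bitDistance true  true  = 0

hamming : ∀ {n} → Vec Bool n → Vec Bool n → ℕ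
hamming []       []       = 0
hamming (x ∷ xs) (y ∷ ys) = bitDistance x y + hamming xs ys

complement : ∀ {n} → Vec Bool n → Vec Bool n
complement = Vec.map not

bitDistance-sym : ∀ x y → bitDistance x y ≡ bitDistance y x
bitDistance-sym false false = refl
bitDistance-sym false true  = refl
bitDistance-sym true  false = refl
bitDistance-sym true  true  = refl

bitDistance-not : ∀ x y → bitDistance x (not y) + bitDistance x y ≡ 1
bitDistance-not false false = refl
bitDistance-not false true  = refl
bitDistance-not true  false = refl
bitDistance-not true  true  = refl

bitDistance≤1 : ∀ x y → bitDistance x y ≤ 1
bitDistance≤1 false false = z≤n
bitDistance≤1 false true  = s≤s z≤n
bitDistance≤1 true  false = s≤s z≤n
bitDistance≤1 true  true  = z≤n

hamming-sym : ∀ {n} (u w : Vec Bool n) → hamming u w ≡ hamming w u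
hamming-sym []       []       = refl
hamming-sym (x ∷ u) (y ∷ w) = cong₂ _+_ (bitDistance-sym x y) (hamming-sym u w)

hamming-self : ∀ {n} (u : Vec Bool n) → hamming u u ≡ 0
hamming-self []          = refl
hamming-self (false ∷ u) = hamming-self u
hamming-self (true ∷ u)  = hamming-self u

hamming≡0⇒≡ : ∀ {n} (u w : Vec Bool n) → hamming u w ≡ 0 → u ≡ w
hamming≡0⇒≡ []          []          _ = refl
hamming≡0⇒≡ (false ∷ u) (false ∷ w) e = cong (false ∷_) (hamming≡0⇒≡ u w e)
hamming≡0⇒≡ (true ∷ u)  (true ∷ w)  e = cong (true ∷_) (hamming≡0⇒≡ u w e)

complement-involutive : ∀ {n} (u : Vec Bool n) → complement (complement u) ≡ u
complement-involutive []          = refl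
complement-involutive (false ∷ u) = cong (false ∷_) (complement-involutive u)
complement-involutive (true ∷ u)  = cong (true ∷_) (complement-involutive u)

complement-injective : ∀ {n} {u w : Vec Bool n} → complement u ≡ complement w → u ≡ w
complement-injective {u = u} {w} e = begin
  u                           ≡⟨ complement-involutive u ⟨
  complement (complement u)   ≡⟨ cong complement e ⟩
  complement (complement w)   ≡⟨ complement-involutive w ⟩
  w                           ∎
  where open ≡-Reasoning

hamming-complement : ∀ {n} (u w : Vec Bool n) → hamming u (complement w) + hamming u w ≡ n
hamming-complement []      []      = refl
hamming-complement {suc n} (x ∷ u) (y ∷ w) = begin
  (bitDistance x (not y) + hamming u (complement w)) + (bitDistance x y + hamming u w)
    ≡⟨ interchange (bitDistance x (not y)) _ (bitDistance x y) _ ⟩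
  (bitDistance x (not y) + bitDistance x y) + (hamming u (complement w) + hamming u w)
    ≡⟨ cong₂ _+_ (bitDistance-not x y) (hamming-complement u w) ⟩
  suc n ∎
  where open ≡-Reasoning

hamming≤ : ∀ {n} (u w : Vec Bool n) → hamming u w ≤ n
hamming≤ u w = subst (hamming u w ≤_) (hamming-complement u w) (m≤n+m _ _)

hamming-complementʳ : ∀ {n} (u w : Vec Bool n) → hamming u (complement w) ≡ n ∸ hamming u w
hamming-complementʳ u w =
  trans (sym (m+n∸n≡m (hamming u (complement w)) (hamming u w)))
        (cong (_∸ hamming u w) (hamming-complement u w))

hamming-complementˡ : ∀ {n} (u w : Vec Bool n) → hamming (complement u) w ≡ n ∸ hamming u w
hamming-complementˡ {n} u w = begin
  hamming (complement u) w   ≡⟨ hamming-sym (complement u) w ⟩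
  hamming w (complement u)   ≡⟨ hamming-complementʳ w u ⟩
  n ∸ hamming w u            ≡⟨ cong (n ∸_) (hamming-sym w u) ⟩
  n ∸ hamming u w            ∎
  where open ≡-Reasoning

hamming-antipode : ∀ {n} (u : Vec Bool n) → hamming u (complement u) ≡ n
hamming-antipode {n} u = trans (hamming-complementʳ u u) (cong (n ∸_) (hamming-self u))

hamming≡n⇒antipode : ∀ {n} (u w : Vec Bool n) → hamming u w ≡ n → w ≡ complement u
hamming≡n⇒antipode {n} u w e = begin
  w                          ≡⟨ complement-involutive w ⟨
  complement (complement w)  ≡⟨ cong complement (hamming≡0⇒≡ u (complement w) to-complement≡0) ⟨
  complement u               ∎
  where
  open ≡-Reasoning
  to-complement≡0 : hamming u (complement w) ≡ 0
  to-complement≡0 =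
    +-cancelʳ-≡ n _ 0 (trans (cong (hamming u (complement w) +_) (sym e)) (hamming-complement u w))

pointwise⇒≡ : ∀ {n} {u w : Vec Bool n} → (∀ i → lookup u i ≡ lookup w i) → u ≡ w
pointwise⇒≡ {u = u} {w} agree =
  trans (sym (tabulate∘lookup u)) (trans (tabulate-cong agree) (tabulate∘lookup w))

adjacent⇒hamming≤1+ : ∀ {n} {u v : Vec Bool n} (w : Vec Bool n) →
                      Graph.Adj (Q n) u v → hamming u w ≤ suc (hamming v w)
adjacent⇒hamming≤1+ {u = x ∷ u} {y ∷ v} (z ∷ w) (zero , _ , agree)
  rewrite pointwise⇒≡ {u = u} {v} (λ i → agree (suc i) (λ ())) =
  ≤-trans (+-monoˡ-≤ (hamming v w) (bitDistance≤1 x z)) (s≤s (m≤n+m _ _))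
adjacent⇒hamming≤1+ {u = x ∷ u} {y ∷ v} (z ∷ w) (suc i , differ , agree)
  rewrite agree zero (λ ()) =
  ≤-trans (+-monoʳ-≤ (bitDistance y z) (adjacent⇒hamming≤1+ {u = u} {v} w tail-adjacent))
          (≤-reflexive (+-suc (bitDistance y z) (hamming v w)))
  where
  tail-adjacent : Graph.Adj (Q _) u v
  tail-adjacent = i , differ , λ j j≢i → agree (suc j) λ { refl → j≢i refl }

walk⇒hamming≤ : ∀ {n} {u w : Vec Bool n} {m} → Walk (Q n) u w m → hamming u w ≤ m
walk⇒hamming≤ {u = u} []              = ≤-reflexive (hamming-self u)
walk⇒hamming≤ {u = u} {w} (_∷_ {v = v} step walk) =
  ≤-trans (adjacent⇒hamming≤1+ {u = u} {v} w step) (s≤s (walk⇒hamming≤ walk))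

adjacent-∷ : ∀ {n} (x : Bool) {u v : Vec Bool n} → Graph.Adj (Q n) u v → Graph.Adj (Q (suc n)) (x ∷ u) (x ∷ v)
adjacent-∷ x (i , differ , agree) = suc i , differ , λ where
  zero    _    → refl
  (suc j) j≢i → agree j λ { refl → j≢i refl }

walk-∷ : ∀ {n} (x : Bool) {u w : Vec Bool n} {m} → Walk (Q n) u w m → Walk (Q (suc n)) (x ∷ u) (x ∷ w) m
walk-∷ x []            = []
walk-∷ x (step ∷ walk) = adjacent-∷ x step ∷ walk-∷ x walk

flip-head : ∀ {n} {x y : Bool} → x ≢ y → (u : Vec Bool n) → Graph.Adj (Q (suc n)) (x ∷ u) (y ∷ u)
flip-head x≢y u = zero , x≢y , λ where
  zero    0≢0 → ⊥-elim (0≢0 refl)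
  (suc j) _   → refl

hammingWalk : ∀ {n} (u w : Vec Bool n) → Walk (Q n) u w (hamming u w)
hammingWalk []          []          = []
hammingWalk (false ∷ u) (false ∷ w) = walk-∷ false (hammingWalk u w)
hammingWalk (false ∷ u) (true ∷ w)  = flip-head (λ ()) u ∷ walk-∷ true (hammingWalk u w)
hammingWalk (true ∷ u)  (false ∷ w) = flip-head (λ ()) u ∷ walk-∷ false (hammingWalk u w)
hammingWalk (true ∷ u)  (true ∷ w)  = walk-∷ true (hammingWalk u w)

hamming-dist : ∀ {n} (u w : Vec Bool n) → Dist (Q n) u w (hamming u w)
hamming-dist u w = hammingWalk u w , λ _ → walk⇒hamming≤

dist⇒hamming : ∀ {n} {u w : Vec Bool n} {d} → Dist (Q n) u w d → hamming u w ≡ d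
dist⇒hamming {u = u} {w} (walk , shortest) = ≤-antisym (walk⇒hamming≤ walk) (shortest _ (hammingWalk u w))

vertexAtHamming : ∀ {n} d → d ≤ n → (u : Vec Bool n) → ∃ λ w → hamming u w ≡ d
vertexAtHamming zero    _         u       = u , hamming-self u
vertexAtHamming (suc d) (s≤s d≤n) (x ∷ u) with vertexAtHamming d d≤n u
... | w , e = not x ∷ w , cong₂ _+_ (not-flips x) e
  where
  not-flips : ∀ x → bitDistance x (not x) ≡ 1
  not-flips false = refl
  not-flips true  = refl

vertexAtDistance : ∀ {n} d → d ≤ n → (u : Vec Bool n) → ∃ λ w → Dist (Q n) u w d
vertexAtDistance d d≤n u with vertexAtHamming d d≤n u
... | w , e = w , subst (Dist (Q _) u w) e (hamming-dist u w)

δ : ℕ → ℕ → ℕ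
δ x c with x ≟ c
... | yes _ = 1
... | no  _ = 0

δ-refl : ∀ x → δ x x ≡ 1
δ-refl x with x ≟ x
... | yes _   = refl
... | no  x≢x = ⊥-elim (x≢x refl)

δ-≢ : ∀ {x c} → x ≢ c → δ x c ≡ 0
δ-≢ {x} {c} x≢c with x ≟ c
... | yes x≡c = ⊥-elim (x≢c x≡c)
... | no  _   = refl

occurrences : ℕ → List ℕ → ℕ
occurrences c []       = 0
occurrences c (x ∷ xs) = δ x c + occurrences c xs

∑≤ : ℕ → (ℕ → ℕ) → ℕ
∑≤ zero    f = f 0
∑≤ (suc K) f = ∑≤ K f + f (suc K)

∑≤-0 : ∀ K → ∑≤ K (λ _ → 0) ≡ 0
∑≤-0 zero    = refl
∑≤-0 (suc K) = trans (+-identityʳ _) (∑≤-0 K)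

∑≤-+ : ∀ K (f g : ℕ → ℕ) → ∑≤ K (λ c → f c + g c) ≡ ∑≤ K f + ∑≤ K g
∑≤-+ zero    f g = refl
∑≤-+ (suc K) f g =
  trans (cong (_+ (f (suc K) + g (suc K))) (∑≤-+ K f g)) (interchange (∑≤ K f) (∑≤ K g) _ _)

∑≤-δ-above : ∀ K {x} → K < x → ∑≤ K (δ x) ≡ 0
∑≤-δ-above zero    K<x = δ-≢ (>⇒≢ K<x)
∑≤-δ-above (suc K) K<x =
  cong₂ _+_ (∑≤-δ-above K (<-trans (n<1+n K) K<x)) (δ-≢ (>⇒≢ K<x))

∑≤-δ : ∀ K {x} → x ≤ K → ∑≤ K (δ x) ≡ 1
∑≤-δ zero    z≤n = refl
∑≤-δ (suc K) {x} x≤1+K with x ≟ suc K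
... | yes refl = cong (_+ 1) (∑≤-δ-above K (n<1+n K))
... | no  x≢1+K = trans (+-identityʳ _) (∑≤-δ K (≤-pred (≤∧≢⇒< x≤1+K x≢1+K)))

∑≤-occurrences : ∀ K {xs} → All (_≤ K) xs → ∑≤ K (λ c → occurrences c xs) ≡ length xs
∑≤-occurrences K []                     = ∑≤-0 K
∑≤-occurrences K {x ∷ xs} (x≤K ∷ xs≤K) =
  trans (∑≤-+ K (δ x) (λ c → occurrences c xs)) (cong₂ _+_ (∑≤-δ K x≤K) (∑≤-occurrences K xs≤K))

∑≤-lower : ∀ K {f} → (∀ {c} → c ≤ K → 1 ≤ f c) → suc K ≤ ∑≤ K f
∑≤-lower zero    positive = positive z≤n
∑≤-lower (suc K) {f} positive = subst (_≤ ∑≤ (suc K) f) (+-comm (suc K) 1)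
  (+-mono-≤ (∑≤-lower K (positive ∘ m≤n⇒m≤1+n)) (positive ≤-refl))

+-tight : ∀ {a b p q} → p ≤ a → q ≤ b → a + b ≡ p + q → a ≡ p × b ≡ q
+-tight {a} {b} {p} {q} p≤a q≤b a+b≡p+q =
  ≤-antisym (+-cancelʳ-≤ q a p (≤-trans (+-monoʳ-≤ a q≤b) (≤-reflexive a+b≡p+q))) p≤a ,
  ≤-antisym (+-cancelˡ-≤ p b q (≤-trans (+-monoˡ-≤ b p≤a) (≤-reflexive a+b≡p+q))) q≤b

∑≤-tight : ∀ K {f} → (∀ {c} → c ≤ K → 1 ≤ f c) → ∑≤ K f ≡ suc K → ∀ {c} → c ≤ K → f c ≡ 1
∑≤-tight zero    positive ∑≡ z≤n   = ∑≡
∑≤-tight (suc K) positive ∑≡ c≤1+K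
  with +-tight (∑≤-lower K (positive ∘ m≤n⇒m≤1+n)) (positive ≤-refl) (trans ∑≡ (+-comm 1 (suc K)))
     | m≤n⇒m<n∨m≡n c≤1+K
... | init≡ , _ | inj₁ c<1+K = ∑≤-tight K (positive ∘ m≤n⇒m≤1+n) init≡ (≤-pred c<1+K)
... | _ , last≡ | inj₂ refl  = last≡

∈⇒1≤occurrences : ∀ {c xs} → c ∈ xs → 1 ≤ occurrences c xs
∈⇒1≤occurrences {c} {_ ∷ xs} (here refl) =
  subst (1 ≤_) (cong (_+ occurrences c xs) (sym (δ-refl c))) (s≤s z≤n)
∈⇒1≤occurrences {c} {x ∷ xs} (there c∈xs) = ≤-trans (∈⇒1≤occurrences c∈xs) (m≤n+m _ (δ x c))

occurs-once-∷ : ∀ {c} x xs → 1 ≤ occurrences c xs → occurrences c (x ∷ xs) ≡ 1 →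
                x ≢ c × occurrences c xs ≡ 1
occurs-once-∷ {c} x xs 1≤occ once with +-tight z≤n 1≤occ once
... | δ≡0 , occ≡1 = (λ { refl → 0≢1+n (trans (sym δ≡0) (δ-refl c)) }) , occ≡1

∈-map⇒1≤occurrences : ∀ {A : Set} (f : A → ℕ) {P x} → x ∈ P → 1 ≤ occurrences (f x) (map f P)
∈-map⇒1≤occurrences f = ∈⇒1≤occurrences ∘ ∈-map⁺ f

occurs-once⇒injective : ∀ {A : Set} (f : A → ℕ) {P : List A} {x y} → x ∈ P → y ∈ P →
                        f x ≡ f y → occurrences (f x) (map f P) ≡ 1 → x ≡ y
occurs-once⇒injective f (here refl) (here refl) _ _ = refl
occurs-once⇒injective f {x ∷ P} (here refl) (there y∈P) fx≡fy once =
  ⊥-elim (proj₁ (occurs-once-∷ (f x) (map f P) fx-occurs once) refl)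
  where
  fx-occurs : 1 ≤ occurrences (f x) (map f P)
  fx-occurs = subst (λ c → 1 ≤ occurrences c (map f P)) (sym fx≡fy) (∈-map⇒1≤occurrences f y∈P)
occurs-once⇒injective f {y ∷ P} (there x∈P) (here refl) fx≡fy once =
  ⊥-elim (proj₁ (occurs-once-∷ (f y) (map f P) (∈-map⇒1≤occurrences f x∈P) once) (sym fx≡fy))
occurs-once⇒injective f {z ∷ P} (there x∈P) (there y∈P) fx≡fy once =
  occurs-once⇒injective f x∈P y∈P fx≡fy
    (proj₂ (occurs-once-∷ (f z) (map f P) (∈-map⇒1≤occurrences f x∈P) once))

Missing : ℕ → List ℕ → Set
Missing K xs = ∃ λ c → c < suc K × c ∉ xs

missing? : ∀ K xs → Dec (Missing K xs)
missing? K xs = anyUpTo? (λ c → ¬? (c ∈? xs)) (suc K)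

¬missing⇒∈ : ∀ {K xs c} → ¬ Missing K xs → c ≤ K → c ∈ xs
¬missing⇒∈ {xs = xs} {c} none c≤K = decidable-stable (c ∈? xs) λ c∉xs → none (c , s≤s c≤K , c∉xs)

¬missing⇒1+K≤length : ∀ {K xs} → All (_≤ K) xs → ¬ Missing K xs → suc K ≤ length xs
¬missing⇒1+K≤length {K} bounded none =
  subst (suc K ≤_) (∑≤-occurrences K bounded) (∑≤-lower K (∈⇒1≤occurrences ∘ ¬missing⇒∈ none))

¬missing⇒occurs-once : ∀ {K xs} → All (_≤ K) xs → ¬ Missing K xs → length xs ≡ suc K →
                       ∀ {c} → c ≤ K → occurrences c xs ≡ 1
¬missing⇒occurs-once {K} bounded none length≡ =
  ∑≤-tight K (∈⇒1≤occurrences ∘ ¬missing⇒∈ none) (trans (∑≤-occurrences K bounded) length≡)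

module Handshake {A : Set} (g : A → A → ℕ) (g-sym : ∀ x y → g x y ≡ g y x) (g-diag : ∀ x → g x x ≡ 0) where

  degree : A → List A → ℕ
  degree q []       = 0
  degree q (r ∷ rs) = g q r + degree q rs

  degreeSum : List A → List A → ℕ
  degreeSum []       rs = 0
  degreeSum (q ∷ qs) rs = degree q rs + degreeSum qs rs

  degreeSum-∷ʳ : ∀ x qs rs → degreeSum qs (x ∷ rs) ≡ degree x qs + degreeSum qs rs
  degreeSum-∷ʳ x []       rs = refl
  degreeSum-∷ʳ x (q ∷ qs) rs = begin
    (g q x + degree q rs) + degreeSum qs (x ∷ rs)
      ≡⟨ cong₂ (λ a b → (a + degree q rs) + b) (g-sym q x) (degreeSum-∷ʳ x qs rs) ⟩
    (g x q + degree q rs) + (degree x qs + degreeSum qs rs)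
      ≡⟨ interchange (g x q) _ _ _ ⟩
    (g x q + degree x qs) + (degree q rs + degreeSum qs rs) ∎
    where open ≡-Reasoning

  handshake : ∀ qs → ∃ λ m → degreeSum qs qs ≡ 2 * m
  handshake []       = 0 , refl
  handshake (x ∷ qs) with handshake qs
  ... | m , degreeSum≡2m = degree x qs + m , (begin
    (g x x + degree x qs) + degreeSum qs (x ∷ qs)
      ≡⟨ cong₂ (λ a b → (a + degree x qs) + b) (g-diag x) (degreeSum-∷ʳ x qs qs) ⟩
    degree x qs + (degree x qs + degreeSum qs qs)
      ≡⟨ cong (λ s → degree x qs + (degree x qs + s)) degreeSum≡2m ⟩
    degree x qs + (degree x qs + 2 * m)
      ≡⟨ double (degree x qs) m ⟩
    2 * (degree x qs + m) ∎)
    where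
    open ≡-Reasoning
    double : ∀ d m → d + (d + 2 * m) ≡ 2 * (d + m)
    double = solve-∀

module OddCube (K : ℕ) where

  n : ℕ
  n = suc (K + K)

  V : Set
  V = Vec Bool n

  target : ℕ
  target = suc (suc K) + suc (suc K)

  Win : V → List V → Set
  Win = Forces (Q n) target

  -- A vertex at distance d from x is at distance n ∸ d from the antipode of x.
  class : ℕ → ℕ
  class d = d ⊓ (n ∸ d)

  class-small : ∀ {d} → d ≤ K → class d ≡ d
  class-small {d} d≤K = m≤n⇒m⊓n≡m
    (≤-trans d≤K (≤-trans (n≤1+n K) (subst (_≤ n ∸ d) (m+n∸n≡m (suc K) K) (∸-monoʳ-≤ n d≤K))))

  class≤K : ∀ d → class d ≤ K
  class≤K d with d ≤? K
  ... | yes d≤K = ≤-trans (m⊓n≤m d (n ∸ d)) d≤K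
  ... | no  d≰K = ≤-trans (m⊓n≤n d (n ∸ d))
                    (subst (n ∸ d ≤_) (m+n∸m≡n (suc K) K) (∸-monoʳ-≤ n (≰⇒> d≰K)))

  class-flip : ∀ {d} → d ≤ n → class (n ∸ d) ≡ class d
  class-flip {d} d≤n = trans (cong ((n ∸ d) ⊓_) (m∸[m∸n]≡n d≤n)) (⊓-comm (n ∸ d) d)

  class-complementˡ : ∀ (u w : V) → class (hamming (complement u) w) ≡ class (hamming u w)
  class-complementˡ u w = trans (cong class (hamming-complementˡ u w)) (class-flip (hamming≤ u w))

  class-complementʳ : ∀ (u w : V) → class (hamming u (complement w)) ≡ class (hamming u w)
  class-complementʳ u w = trans (cong class (hamming-complementʳ u w)) (class-flip (hamming≤ u w))

  view : V → List V → List ℕ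
  view x = map (λ r → class (hamming x r))

  view-bounded : ∀ x P → All (_≤ K) (view x P)
  view-bounded x P = map⁺ (All.universal (λ r → class≤K (hamming x r)) P)

  Meets : V → V → Set
  Meets q r = q ≡ r ⊎ q ≡ complement r

  Apart : V → V → Set
  Apart q r = ¬ Meets q r

  meets? : ∀ q r → Dec (Meets q r)
  meets? q r = ≡-dec _≟ᵇ_ q r ⊎-dec ≡-dec _≟ᵇ_ q (complement r)

  meets⇒class≡ : ∀ x {w r} → Meets w r → class (hamming x w) ≡ class (hamming x r)
  meets⇒class≡ x         (inj₁ refl) = refl
  meets⇒class≡ x {r = r} (inj₂ refl) = class-complementʳ x r

  meets⇒view≡ : ∀ {w r} → Meets w r → ∀ P → view w P ≡ view r P
  meets⇒view≡         (inj₁ refl) P = refl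
  meets⇒view≡ {r = r} (inj₂ refl) P = map-cong (class-complementˡ r) P

  Collected : List V → List V → Set
  Collected P vis = AllPairs Apart P × All (λ q → q ∈ vis × complement q ∈ vis) P

  withAntipodes : List V → List V
  withAntipodes []      = []
  withAntipodes (q ∷ P) = q ∷ complement q ∷ withAntipodes P

  length-withAntipodes : ∀ P → length (withAntipodes P) ≡ length P + length P
  length-withAntipodes []      = refl
  length-withAntipodes (q ∷ P) =
    cong suc (trans (cong suc (length-withAntipodes P)) (sym (+-suc (length P) (length P))))

  ≢antipode : ∀ (q : V) → q ≢ complement q
  ≢antipode q q≡q̄ = 0≢1+n (trans (sym (hamming-self q)) (trans (cong (hamming q) q≡q̄) (hamming-antipode q)))

  apart⇒≢ : ∀ {q P} → All (Apart q) P → All (q ≢_) (withAntipodes P)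
  apart⇒≢ []           = []
  apart⇒≢ (apart ∷ as) = apart ∘ inj₁ ∷ apart ∘ inj₂ ∷ apart⇒≢ as

  apart⇒antipode≢ : ∀ {q P} → All (Apart q) P → All (complement q ≢_) (withAntipodes P)
  apart⇒antipode≢     []           = []
  apart⇒antipode≢ {q} (apart ∷ as) =
    (λ q̄≡r → apart (inj₂ (trans (sym (complement-involutive q)) (cong complement q̄≡r)))) ∷
    apart ∘ inj₁ ∘ complement-injective ∷ apart⇒antipode≢ as

  withAntipodes-unique : ∀ {P} → AllPairs Apart P → AllPairs _≢_ (withAntipodes P)
  withAntipodes-unique []                   = []
  withAntipodes-unique {q ∷ _} (apart ∷ as) =
    (≢antipode q ∷ apart⇒≢ apart) ∷ apart⇒antipode≢ apart ∷ withAntipodes-unique as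

  withAntipodes-visited : ∀ {P vis} → All (λ q → q ∈ vis × complement q ∈ vis) P →
                          All (_∈ vis) (withAntipodes P)
  withAntipodes-visited []                  = []
  withAntipodes-visited ((q∈ , q̄∈) ∷ rest) = q∈ ∷ q̄∈ ∷ withAntipodes-visited rest

  collected⇒win : ∀ {P vis x} → Collected P vis → length P ≡ suc (suc K) → Win x vis
  collected⇒win {P} (apart , visited) length≡ =
    done (withAntipodes P , trans (length-withAntipodes P) (cong₂ _+_ length≡ length≡) ,
          withAntipodes-unique apart , withAntipodes-visited visited)

  collected-visit : ∀ {P vis x} → Collected P vis → Collected P (x ∷ vis)
  collected-visit (apart , visited) = apart , All.map (λ (q∈ , q̄∈) → there q∈ , there q̄∈) visited

  collected-∷ : ∀ {P vis w} → Collected P vis → All (Apart w) P → Collected (w ∷ P) (complement w ∷ w ∷ vis)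
  collected-∷ (apart , visited) w-apart =
    w-apart ∷ apart ,
    (there (here refl) , here refl) ∷ All.map (λ (q∈ , q̄∈) → there (there q∈) , there (there q̄∈)) visited

  toAntipode : ∀ {vis} w → Win (complement w) (complement w ∷ w ∷ vis) → Win w (w ∷ vis)
  toAntipode {vis} w win =
    move n (complement w , subst (Dist (Q n) w (complement w)) (hamming-antipode w) (hamming-dist w _))
      λ w′ d →
        subst (λ z → Win z (z ∷ w ∷ vis)) (sym (hamming≡n⇒antipode w w′ (dist⇒hamming d))) win

  gain : ∀ {P vis c} x → Collected P vis → c ≤ K → c ∉ view x P →
         (∀ w → Collected (w ∷ P) (complement w ∷ w ∷ vis) → Win (complement w) (complement w ∷ w ∷ vis)) →
         Win x vis
  gain {P} {vis} {c} x collected c≤K c∉view continue =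
    move c (vertexAtDistance c c≤n x) λ w d →
      toAntipode w (continue w (collected-∷ collected (All.tabulate (apart (dist⇒hamming d)))))
    where
    c≤n : c ≤ n
    c≤n = ≤-trans c≤K (≤-trans (m≤m+n K K) (n≤1+n _))
    apart : ∀ {w} → hamming x w ≡ c → ∀ {r} → r ∈ P → Apart w r
    apart distance≡c {r} r∈P meets = c∉view (subst (_∈ view x P) class≡c (∈-map⁺ _ r∈P))
      where
      class≡c : class (hamming x r) ≡ c
      class≡c = trans (sym (meets⇒class≡ x meets)) (trans (cong class distance≡c) (class-small c≤K))

  module ClassOneGraph = Handshake {V} (λ q r → δ (class (hamming q r)) 1)
    (λ q r → cong (λ d → δ (class d) 1) (hamming-sym q r)) (λ q → cong (λ d → δ (class d) 1) (hamming-self q))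
  open ClassOneGraph using (degree; degreeSum; handshake)

  degree≡occurrences : ∀ q rs → degree q rs ≡ occurrences 1 (view q rs)
  degree≡occurrences q []       = refl
  degree≡occurrences q (r ∷ rs) = cong (δ (class (hamming q r)) 1 +_) (degree≡occurrences q rs)

  module _ {k} (K≡2k : K ≡ 2 * k) (1≤K : 1 ≤ K) where

    someViewMisses : ∀ {Ps} → length Ps ≡ suc K → Any (λ q → Missing K (view q Ps)) Ps
    someViewMisses {Ps} length≡ with any? (λ q → missing? K (view q Ps)) Ps | handshake Ps
    ... | yes some | _           = some
    ... | no  none | m , sum≡2m = ⊥-elim (even≢odd m k (begin
      2 * m             ≡⟨ sum≡2m ⟨
      degreeSum Ps Ps   ≡⟨ regular (¬Any⇒All¬ Ps none) ⟩
      length Ps         ≡⟨ length≡ ⟩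
      suc K             ≡⟨ cong suc K≡2k ⟩
      suc (2 * k)       ∎))
      where
      open ≡-Reasoning
      regular : ∀ {qs} → All (λ q → ¬ Missing K (view q Ps)) qs → degreeSum qs Ps ≡ length qs
      regular []                      = refl
      regular {q ∷ _} (covered ∷ rest) = cong₂ _+_
        (trans (degree≡occurrences q Ps)
               (¬missing⇒occurs-once (view-bounded q Ps) covered (trans (length-map _ Ps) length≡) 1≤K))
        (regular rest)

    -- Every class is hit exactly once from t, so a vertex meeting Ps at the distance of q meets q.
    lastPair : ∀ {w P vis} → length (w ∷ P) ≡ suc K →
               ¬ Missing K (view (complement w) (w ∷ P)) → Collected (w ∷ P) vis → Win (complement w) vis
    lastPair {w} {P} {vis} length≡ covered collected with find (someViewMisses length≡)
    ... | q , q∈Ps , c , c<1+K , c∉view =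
      move (hamming t q) (vertexAtDistance _ (hamming≤ t q) t) λ w′ d → respond w′ (dist⇒hamming d)
      where
      Ps = w ∷ P
      t  = complement w

      complete : ∀ {y vis′ x} → Collected (y ∷ Ps) vis′ → Win x vis′
      complete collected′ = collected⇒win collected′ (cong suc length≡)

      respond : ∀ w′ → hamming t w′ ≡ hamming t q → Win w′ (w′ ∷ vis)
      respond w′ same with any? (meets? w′) Ps
      ... | no  apart = toAntipode w′ (complete (collected-∷ collected (¬Any⇒All¬ Ps apart)))
      ... | yes meetsSome with find meetsSome
      ...   | r , r∈Ps , w′-meets-r =
        gain w′ (collected-visit collected) (≤-pred c<1+K) (subst (c ∉_) (sym view≡) c∉view) λ _ → complete
        where
        r≡q : r ≡ q
        r≡q = occurs-once⇒injective (λ s → class (hamming t s)) r∈Ps q∈Ps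
                (trans (sym (meets⇒class≡ t w′-meets-r)) (cong class same))
                (¬missing⇒occurs-once (view-bounded t Ps) covered (trans (length-map _ Ps) length≡) (class≤K _))
        view≡ : view w′ Ps ≡ view q Ps
        view≡ = trans (meets⇒view≡ w′-meets-r Ps) (cong (λ s → view s Ps) r≡q)

    fromAntipode : ∀ j {w P vis} → length (w ∷ P) + j ≡ suc (suc K) →
                   Collected (w ∷ P) vis → Win (complement w) vis
    fromAntipode zero length≡ collected = collected⇒win collected (trans (sym (+-identityʳ _)) length≡)
    fromAntipode (suc j) {w} {P} length≡ collected with missing? K (view (complement w) (w ∷ P))
    ... | yes (c , c<1+K , c∉view) =
      gain _ collected (≤-pred c<1+K) c∉view λ _ →
        fromAntipode j (trans (sym (+-suc _ j)) length≡)
    ... | no covered = lastPair (≤-antisym at-most at-least) covered collected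
      where
      at-most : length (w ∷ P) ≤ suc K
      at-most = subst (length (w ∷ P) ≤_) (suc-injective (trans (sym (+-suc _ j)) length≡)) (m≤m+n _ j)
      at-least : suc K ≤ length (w ∷ P)
      at-least = subst (suc K ≤_) (length-map _ (w ∷ P))
                   (¬missing⇒1+K≤length (view-bounded (complement w) (w ∷ P)) covered)

    explorerWins : (v : V) → fd-≥ (Q n) v target
    explorerWins v = toAntipode v (fromAntipode (suc K) refl (collected-∷ ([] , []) []))

dimension≡ : ∀ k → 4 * k + 1 ≡ suc (2 * k + 2 * k)
dimension≡ = solve-∀

target≡ : ∀ k → 4 * k + 4 ≡ suc (suc (2 * k)) + suc (suc (2 * k))
target≡ = solve-∀

lemma4p5 : (k : ℕ) → 1 ≤ k → (v : Vec Bool (4 * k + 1)) → fd-≥ (Q (4 * k + 1)) v (4 * k + 4)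
lemma4p5 k 1≤k v rewrite dimension≡ k | target≡ k =
  OddCube.explorerWins (2 * k) {k} refl (≤-trans 1≤k (m≤m+n k _)) v
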